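{- Let $A,B,C$ be finite groups with $A$ abelian. Then there are epimorphisms $A\wr(B\wr C)\to (A\wr B)\wr C\to (A\times B)\wr C$.
   Context: For groups $H,G$, the standard wreath product $H\wr G$ is the set of pairs $(f,g)$, $f:G\to H$ a function, $g\in G$, with multiplication $(f_1,g_1)(f_2,g_2)=(f_1f_2^{g_1^{ -1}},g_1g_2)$, where $f^{g^{ -1}}(x)=f(xg)$. -}

module Defs where

open import Level using (Level; _⊔_)
open import Data.Nat using (ℕ)
open import Data.Fin using (Fin)
open import Data.Product using (Σ; ∃; _×_; _,_; proj₁; proj₂)
open import Function.Bundles using (Func; Bijection)
open import Relation.Binary.Bundles using (Setoid)
import Relation.Binary.PropositionalEquality as ≡
open import Algebra.Bundles using (Group; AbelianGroup)
open import Algebra.Morphism.Structures using (IsGroupHomomorphism)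
import Algebra.Properties.Group as GP

private
  variable
    c₁ ℓ₁ c₂ ℓ₂ : Level

Finite : Group c₁ ℓ₁ → Set (c₁ ⊔ ℓ₁)
Finite G = Σ ℕ λ n → Bijection (≡.setoid (Fin n)) (Group.setoid G)

record Epimorphism (G : Group c₁ ℓ₁) (H : Group c₂ ℓ₂) : Set (c₁ ⊔ ℓ₁ ⊔ c₂ ⊔ ℓ₂) where
  field
    ⟦_⟧           : Group.Carrier G → Group.Carrier H
    isHomomorphism : IsGroupHomomorphism (Group.rawGroup G) (Group.rawGroup H) ⟦_⟧
    surjective     : ∀ y → ∃ λ x → Group._≈_ H ⟦ x ⟧ y

-- Standard wreath product H ≀ G: pairs (f , g), f : G → H (a setoid map), g ∈ G,
-- (f₁ , g₁)(f₂ , g₂) = (f₁ f₂^{g₁⁻¹} , g₁ g₂)  where  f^{g⁻¹}(x) = f (x g).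
module Wreath (H : Group c₁ ℓ₁) (G : Group c₂ ℓ₂) where
  private
    module H = Group H
    module G = Group G
    module HS = Setoid H.setoid
    module GP' = GP G

  Fun : Set (c₁ ⊔ ℓ₁ ⊔ c₂ ⊔ ℓ₂)
  Fun = Func G.setoid H.setoid

  Carrier : Set (c₁ ⊔ ℓ₁ ⊔ c₂ ⊔ ℓ₂)
  Carrier = Fun × G.Carrier

  _≈_ : Carrier → Carrier → Set (ℓ₁ ⊔ c₂ ⊔ ℓ₂)
  (f , g) ≈ (f' , g') = (∀ x → Func.to f x H.≈ Func.to f' x) × (g G.≈ g')

  _∙_ : Carrier → Carrier → Carrier
  (f₁ , g₁) ∙ (f₂ , g₂) =
    record { to = λ x → Func.to f₁ x H.∙ Func.to f₂ (x G.∙ g₁)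
           ; cong = λ p → H.∙-cong (Func.cong f₁ p) (Func.cong f₂ (G.∙-congʳ p)) }
    , g₁ G.∙ g₂

  ε : Carrier
  ε = record { to = λ _ → H.ε ; cong = λ _ → H.refl } , G.ε

  _⁻¹ : Carrier → Carrier
  (f , g) ⁻¹ =
    record { to = λ x → Func.to f (x G.∙ g G.⁻¹) H.⁻¹
           ; cong = λ p → H.⁻¹-cong (Func.cong f (G.∙-congʳ p)) }
    , g G.⁻¹

  group : Group (c₁ ⊔ ℓ₁ ⊔ c₂ ⊔ ℓ₂) (ℓ₁ ⊔ c₂ ⊔ ℓ₂)
  group = record
    { Carrier = Carrier
    ; _≈_ = _≈_
    ; _∙_ = _∙_
    ; ε = ε
    ; _⁻¹ = _⁻¹
    ; isGroup = record
      { isMonoid = record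
        { isSemigroup = record
          { isMagma = record
            { isEquivalence = record
              { refl = (λ _ → H.refl) , G.refl
              ; sym = λ (p , q) → (λ x → H.sym (p x)) , G.sym q
              ; trans = λ (p , q) (p' , q') → (λ x → H.trans (p x) (p' x)) , G.trans q q'
              }
            ; ∙-cong = λ { {f₁ , g₁} {f₁' , g₁'} {f₂ , g₂} {f₂' , g₂'} (p , q) (p' , q') →
                (λ x → H.∙-cong (p x) (H.trans (Func.cong f₂ (G.∙-congˡ q)) (p' _)))
                , G.∙-cong q q' }
            }
          ; assoc = λ { (f₁ , g₁) (f₂ , g₂) (f₃ , g₃) →
              (λ x → H.trans (H.assoc _ _ _)
                       (H.∙-congˡ (H.∙-congˡ (Func.cong f₃ (G.sym (G.assoc x g₁ g₂))))))
              , G.assoc g₁ g₂ g₃ }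
          }
        ; identity = (λ { (f , g) → (λ x → H.trans (H.identityˡ _) (Func.cong f (G.identityʳ x)))
                                    , G.identityˡ g })
                   , (λ { (f , g) → (λ x → H.identityʳ _) , G.identityʳ g })
        }
      ; inverse = (λ { (f , g) → (λ x → H.inverseˡ _) , G.inverseˡ g })
                , (λ { (f , g) → (λ x → H.trans
                          (H.∙-congˡ (H.⁻¹-cong (Func.cong f
                             (G.trans (G.assoc x g (g G.⁻¹))
                               (G.trans (G.∙-congˡ (G.inverseʳ g)) (G.identityʳ x))))))
                          (H.inverseʳ _))
                          , G.inverseʳ g })
      ; ⁻¹-cong = λ { {f , g} {f' , g'} (p , q) →
          (λ x → H.⁻¹-cong (H.trans (Func.cong f (G.∙-congˡ (G.⁻¹-cong q))) (p _)))
          , G.⁻¹-cong q }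
      }
    }

infixr 6 _≀_
_≀_ : Group c₁ ℓ₁ → Group c₂ ℓ₂ → Group (c₁ ⊔ ℓ₁ ⊔ c₂ ⊔ ℓ₂) (ℓ₁ ⊔ c₂ ⊔ ℓ₂)
H ≀ G = Wreath.group H G

module Submission where

-- Let A be abelian and B, C finite.  Both epimorphisms are built by summing
-- values of A over finite sets.
--
-- The augmentation A ≀ B → A × B,
--   (g , b) ↦ (Σ_y g(y) , b), is a homomorphism because a sum over the finite
--   group B is additive and invariant under right translation; it has the
--   section (a , b) ↦ (δ_a , b).  A homomorphism with a section induces, by
--   acting pointwise, an epimorphism of wreath products over any base C.
--
-- * A ≀ (B ≀ C) → (A ≀ B) ≀ C sends (F , (f , c)) to (x ↦ (F_x , f(x)) , c),
--   where F_x(y) is the fibre sum of F(h , x) over all h : C → B with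
--   h(1) = y.  Maps C → B are coded by tuples indexed by an enumeration of C,
--   so fibre sums are iterated sums over B; their translation invariance
--   turns the twisted product of A ≀ (B ≀ C) into that of (A ≀ B) ≀ C, and a
--   function supported on constant maps h shows surjectivity.

open import Defs
open import Level using (Level)
open import Data.Product using (_×_; _,_; proj₁; proj₂; ∃)
open import Algebra.Bundles using (Group; AbelianGroup; Monoid; CommutativeMonoid)
open import Algebra.Construct.DirectProduct using (group)
open import Algebra.Morphism.Structures using (IsGroupHomomorphism)
open import Data.Nat using (ℕ; zero; suc)
open import Data.Fin using (Fin; zero; suc)
import Data.Fin as Fin
import Data.Fin.Properties as FinProperties
open import Data.Fin.Permutation using (permutation)
open import Data.Vec.Functional using (_∷_; tail)
open import Function using (id; _∘_)
open import Function.Bundles using (Func; Inverse)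
open import Function.Properties.Bijection using (Bijection⇒Inverse)
import Function.Construct.Composition as Composition
open import Relation.Nullary using (Dec; yes; no; ¬_)
open import Relation.Nullary.Decidable using (map′)
open import Relation.Binary.Definitions using (Decidable)
open import Data.Empty using (⊥-elim)
import Relation.Binary.PropositionalEquality as ≡
import Algebra.Properties.Group as GroupProperties
import Algebra.Properties.CommutativeMonoid.Sum as SumProperties
import Relation.Binary.Reasoning.Setoid as SetoidReasoning

module _ {c₁ ℓ₁ c₂ ℓ₂} (G : Group c₁ ℓ₁) (H : Group c₂ ℓ₂) where
  private
    module G = Group G
    module H = Group H

  multiplicative⇒homomorphism :
    (f : G.Carrier → H.Carrier) →
    (∀ {x y} → x G.≈ y → f x H.≈ f y) →
    (∀ x y → f (x G.∙ y) H.≈ f x H.∙ f y) →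
    IsGroupHomomorphism G.rawGroup H.rawGroup f
  multiplicative⇒homomorphism f cong homo = record
    { isMonoidHomomorphism = record
      { isMagmaHomomorphism = record
        { isRelHomomorphism = record { cong = cong } ; homo = homo }
      ; ε-homo = ε-homo }
    ; ⁻¹-homo = λ x → GroupProperties.inverseˡ-unique H (f (x G.⁻¹)) (f x)
        (H.trans (H.sym (homo (x G.⁻¹) x)) (H.trans (cong (G.inverseˡ x)) ε-homo)) }
    where
    -- f(ε) is idempotent, hence the unit.
    ε-homo : f G.ε H.≈ H.ε
    ε-homo = GroupProperties.identityˡ-unique H (f G.ε) (f G.ε)
               (H.trans (H.sym (homo G.ε G.ε)) (cong (G.identityˡ G.ε)))

module _ {k ℓk k' ℓk' g ℓg} (K : Group k ℓk) (K' : Group k' ℓk') (G : Group g ℓg) where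
  private
    module K' = Group K'
    module G = Group G
    module W = Group (K ≀ G)
    module W' = Group (K' ≀ G)

  splitEpimorphism≀ :
    (θ : Group.Carrier K → K'.Carrier) →
    IsGroupHomomorphism (Group.rawGroup K) K'.rawGroup θ →
    (s : Func K'.setoid (Group.setoid K)) → (∀ y → θ (Func.to s y) K'.≈ y) →
    Epimorphism (K ≀ G) (K' ≀ G)
  splitEpimorphism≀ θ θ-hom s θ∘s≈id = record
    { ⟦_⟧ = lift
    ; isHomomorphism = multiplicative⇒homomorphism (K ≀ G) (K' ≀ G) lift
        (λ { (p , q) → (λ x → ⟦⟧-cong (p x)) , q })
        (λ { (f₁ , g₁) (f₂ , _) → (λ x → θ-homo _ _) , G.refl })
    ; surjective = λ { (f , g) → (Composition.function f s , g) , ((λ x → θ∘s≈id _) , G.refl) } }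
    where
    open IsGroupHomomorphism θ-hom using (⟦⟧-cong) renaming (homo to θ-homo)

    lift : W.Carrier → W'.Carrier
    lift (f , g) = record { to = θ ∘ Func.to f ; cong = ⟦⟧-cong ∘ Func.cong f } , g

module Enumeration {c ℓ} (G : Group c ℓ) (finite : Finite G) where
  open Group G

  size : ℕ
  size = proj₁ finite

  open Inverse (Bijection⇒Inverse (proj₂ finite)) public
    using ()
    renaming ( to to element ; from to index ; from-cong to index-cong
             ; strictlyInverseˡ to element-index ; strictlyInverseʳ to index-element )

  index-of : ∀ {x} i → x ≈ element i → index x ≡.≡ i
  index-of i p = ≡.trans (index-cong p) (index-element i)

  _≟_ : Decidable _≈_
  x ≟ y = map′ (λ p → trans (sym (element-index x)) (trans (reflexive (≡.cong element p)) (element-index y)))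
               index-cong (index x Fin.≟ index y)

module Conditional {m ℓ} (M : Monoid m ℓ) where
  open Monoid M

  when : ∀ {p} {P : Set p} → Dec P → Carrier → Carrier
  when (yes _) x = x
  when (no _)  _ = ε

  when-yes : ∀ {p} {P : Set p} (d : Dec P) {x} → P → when d x ≈ x
  when-yes (yes _) _ = refl
  when-yes (no ¬p) p = ⊥-elim (¬p p)

  when-no : ∀ {p} {P : Set p} (d : Dec P) {x} → ¬ P → when d x ≈ ε
  when-no (yes p) ¬p = ⊥-elim (¬p p)
  when-no (no _)  _  = refl

  when-cong : ∀ {p q} {P : Set p} {Q : Set q} (dp : Dec P) (dq : Dec Q) {x y} →
              (P → Q) → (Q → P) → (P → x ≈ y) → when dp x ≈ when dq y
  when-cong (yes p) dq P⇒Q Q⇒P x≈y = trans (x≈y p) (sym (when-yes dq (P⇒Q p)))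
  when-cong (no ¬p) dq P⇒Q Q⇒P x≈y = sym (when-no dq (¬p ∘ Q⇒P))

  when-congʳ : ∀ {p} {P : Set p} (d : Dec P) {x y} → x ≈ y → when d x ≈ when d y
  when-congʳ d x≈y = when-cong d d id id (λ _ → x≈y)

  when-∙ : ∀ {p} {P : Set p} (d : Dec P) x y → when d (x ∙ y) ≈ when d x ∙ when d y
  when-∙ (yes _) x y = refl
  when-∙ (no _)  x y = sym (identityˡ ε)

  when-∧ : ∀ {p₁ p₂ p} {P₁ : Set p₁} {P₂ : Set p₂} {P : Set p}
           (d₁ : Dec P₁) (d₂ : Dec P₂) (d : Dec P) {x y} →
           (P₁ → P₂ → P) → (P → P₁ × P₂) → (P → x ≈ y) →
           when d₁ (when d₂ x) ≈ when d y
  when-∧ (yes p₁) d₂ d P₁⇒P₂⇒P P⇒P₁P₂ x≈y =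
    when-cong d₂ d (P₁⇒P₂⇒P p₁) (proj₂ ∘ P⇒P₁P₂) (x≈y ∘ P₁⇒P₂⇒P p₁)
  when-∧ (no ¬p₁) d₂ d P₁⇒P₂⇒P P⇒P₁P₂ x≈y = sym (when-no d (¬p₁ ∘ proj₁ ∘ P⇒P₁P₂))

module FiniteSum {m ℓm g ℓg} (M : CommutativeMonoid m ℓm) (G : Group g ℓg) (finite : Finite G) where
  open CommutativeMonoid M
  open SumProperties M using (sum; sum-cong-≋; sum-remove; sum-replicate-zero; sum-permute; ∑-distrib-+)
  open SetoidReasoning setoid
  private
    module G = Group G
    module GP = GroupProperties G
    open module E = Enumeration G finite using (size; element; index; index-of; element-index)

  open E public using (_≟_)
  open Conditional monoid public

  Σ : (G.Carrier → Carrier) → Carrier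
  Σ φ = sum (φ ∘ element)

  Σ-cong : ∀ {φ ψ} → (∀ y → φ y ≈ ψ y) → Σ φ ≈ Σ ψ
  Σ-cong φ≈ψ = sum-cong-≋ (φ≈ψ ∘ element)

  Σ-distrib : ∀ φ ψ → Σ (λ y → φ y ∙ ψ y) ≈ Σ φ ∙ Σ ψ
  Σ-distrib φ ψ = ∑-distrib-+ (φ ∘ element) (ψ ∘ element)

  private
    sum-zero : ∀ {n} (t : Fin n → Carrier) → (∀ i → t i ≈ ε) → sum t ≈ ε
    sum-zero {n} t t≈ε = trans (sum-cong-≋ t≈ε) (sum-replicate-zero n)

  Σ-zero : ∀ φ → (∀ y → φ y ≈ ε) → Σ φ ≈ ε
  Σ-zero φ φ≈ε = sum-zero (φ ∘ element) (φ≈ε ∘ element)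

  -- Right translation permutes G, so it does not change sums.
  Σ-shift : ∀ φ → (∀ {y z} → y G.≈ z → φ y ≈ φ z) → ∀ k → Σ (λ y → φ (y G.∙ k)) ≈ Σ φ
  Σ-shift φ φ-cong k = sym (begin
    Σ φ                                              ≈⟨ sum-permute (φ ∘ element) translation ⟩
    sum (λ i → φ (element (index (element i G.∙ k)))) ≈⟨ sum-cong-≋ (λ i → φ-cong (element-index (element i G.∙ k))) ⟩
    Σ (λ y → φ (y G.∙ k))                            ∎)
    where
    translation = permutation {m = size} {n = size} (λ i → index (element i G.∙ k)) (λ j → index (element j G.∙ k G.⁻¹))
      (λ j → index-of j (G.trans (G.∙-congʳ (element-index _)) (GP.//-rightDividesˡ k (element j))))
      (λ j → index-of j (G.trans (G.∙-congʳ (element-index _)) (GP.//-rightDividesʳ k (element j))))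

  Σ-delta : ∀ y x → Σ (λ z → when (z ≟ y) x) ≈ x
  Σ-delta y x = sum-delta (λ i → when (element i ≟ y) x) (index y)
    (when-yes (element (index y) ≟ y) (element-index y))
    (λ j j≢i → when-no (element j ≟ y) (λ p → j≢i (≡.sym (index-of j (G.sym p)))))
    where
    sum-delta : ∀ {n} (t : Fin n → Carrier) i → t i ≈ x → (∀ j → j ≡.≢ i → t j ≈ ε) → sum t ≈ x
    sum-delta {suc n} t i tᵢ≈x rest≈ε = begin
      sum t                                ≈⟨ sum-remove {i = i} t ⟩
      t i ∙ sum (t ∘ Fin.punchIn i)        ≈⟨ ∙-cong tᵢ≈x (sum-zero _ (λ j → rest≈ε _ (FinProperties.punchInᵢ≢i i j))) ⟩
      x ∙ ε                                ≈⟨ identityʳ x ⟩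
      x                                    ∎

  Tuple : ℕ → Set g
  Tuple k = Fin k → G.Carrier

  _≐_ : ∀ {k} → Tuple k → Tuple k → Set ℓg
  v ≐ w = ∀ i → v i G.≈ w i

  _≐?_ : ∀ {k} → Decidable (_≐_ {k})
  v ≐? w = FinProperties.all? (λ i → v i ≟ w i)

  Σⁿ : ∀ k → (Tuple k → Carrier) → Carrier
  Σⁿ zero    φ = φ (λ ())
  Σⁿ (suc k) φ = Σ (λ y → Σⁿ k (λ v → φ (y ∷ v)))

  Σⁿ-cong : ∀ k {φ ψ} → (∀ v → φ v ≈ ψ v) → Σⁿ k φ ≈ Σⁿ k ψ
  Σⁿ-cong zero    φ≈ψ = φ≈ψ _
  Σⁿ-cong (suc k) φ≈ψ = Σ-cong (λ y → Σⁿ-cong k (λ v → φ≈ψ (y ∷ v)))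

  Σⁿ-distrib : ∀ k φ ψ → Σⁿ k (λ v → φ v ∙ ψ v) ≈ Σⁿ k φ ∙ Σⁿ k ψ
  Σⁿ-distrib zero    φ ψ = refl
  Σⁿ-distrib (suc k) φ ψ = trans (Σ-cong (λ y → Σⁿ-distrib k (λ v → φ (y ∷ v)) (λ v → ψ (y ∷ v))))
                                 (Σ-distrib (λ y → Σⁿ k (λ v → φ (y ∷ v))) (λ y → Σⁿ k (λ v → ψ (y ∷ v))))

  Σⁿ-zero : ∀ k φ → (∀ v → φ v ≈ ε) → Σⁿ k φ ≈ ε
  Σⁿ-zero zero    φ φ≈ε = φ≈ε _
  Σⁿ-zero (suc k) φ φ≈ε = Σ-zero _ (λ y → Σⁿ-zero k _ (λ v → φ≈ε (y ∷ v)))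

  Σⁿ-shift : ∀ k φ → (∀ {v w} → v ≐ w → φ v ≈ φ w) → (κ : Tuple k) →
             Σⁿ k (λ v → φ (λ i → v i G.∙ κ i)) ≈ Σⁿ k φ
  Σⁿ-shift zero    φ φ-cong κ = φ-cong (λ ())
  Σⁿ-shift (suc k) φ φ-cong κ = begin
    Σ (λ y → Σⁿ k (λ v → φ (λ i → (y ∷ v) i G.∙ κ i)))
      ≈⟨ Σ-cong (λ y → Σⁿ-cong k (λ v → φ-cong (cons-shift y v))) ⟩
    Σ (λ y → Σⁿ k (λ v → φ ((y G.∙ κ zero) ∷ (λ i → v i G.∙ κ (suc i)))))
      ≈⟨ Σ-cong (λ y → Σⁿ-shift k (λ v → φ ((y G.∙ κ zero) ∷ v)) (λ v≐w → φ-cong (cons-cong G.refl v≐w)) (tail κ)) ⟩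
    Σ (λ y → Σⁿ k (λ v → φ ((y G.∙ κ zero) ∷ v)))
      ≈⟨ Σ-shift _ (λ y≈z → Σⁿ-cong k (λ v → φ-cong (cons-cong y≈z (λ _ → G.refl)))) (κ zero) ⟩
    Σ (λ y → Σⁿ k (λ v → φ (y ∷ v)))  ∎
    where
    cons-cong : ∀ {y z} {v w : Tuple k} → y G.≈ z → v ≐ w → (y ∷ v) ≐ (z ∷ w)
    cons-cong y≈z v≐w zero    = y≈z
    cons-cong y≈z v≐w (suc i) = v≐w i

    cons-shift : ∀ y v → (λ i → (y ∷ v) i G.∙ κ i) ≐ ((y G.∙ κ zero) ∷ (λ i → v i G.∙ κ (suc i)))
    cons-shift y v zero    = G.refl
    cons-shift y v (suc i) = G.refl

  Σⁿ-delta : ∀ k (w : Tuple k) x → Σⁿ k (λ v → when (v ≐? w) x) ≈ x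
  Σⁿ-delta zero    w x = when-yes ((λ ()) ≐? w) (λ ())
  Σⁿ-delta (suc k) w x = trans (Σ-cong (λ y → slice y (y ≟ w zero))) (Σ-delta (w zero) x)
    where
    slice : ∀ y (d : Dec (y G.≈ w zero)) → Σⁿ k (λ v → when ((y ∷ v) ≐? w) x) ≈ when d x
    slice y (yes y≈w₀) = trans
      (Σⁿ-cong k (λ v → when-cong ((y ∷ v) ≐? w) (v ≐? tail w) (λ e → e ∘ suc)
                   (λ e → λ { zero → y≈w₀ ; (suc i) → e i }) (λ _ → refl)))
      (Σⁿ-delta k (tail w) x)
    slice y (no y≉w₀) = Σⁿ-zero k _ (λ v → when-no ((y ∷ v) ≐? w) (λ e → y≉w₀ (e zero)))

module WreathEpimorphisms {a ℓa b ℓb c ℓc}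
  (AG : AbelianGroup a ℓa) (B : Group b ℓb) (C : Group c ℓc)
  (finB : Finite B) (finC : Finite C) where

  A : Group a ℓa
  A = AbelianGroup.group AG

  private
    module A = AbelianGroup AG
    module B = Group B
    module C = Group C
    module BP = GroupProperties B
    module BC = Group (B ≀ C)
    module AB = Group (A ≀ B)
    module A×B = Group (group A B)
    module W₁ = Group (A ≀ (B ≀ C))
    module W₂ = Group ((A ≀ B) ≀ C)
    module EC = Enumeration C finC
  open FiniteSum A.commutativeMonoid B finB
  open SetoidReasoning A.setoid

  augment : AB.Carrier → A×B.Carrier
  augment (g , b) = Σ (Func.to g) , b

  augment-homomorphism : IsGroupHomomorphism AB.rawGroup A×B.rawGroup augment
  augment-homomorphism = multiplicative⇒homomorphism (A ≀ B) (group A B) augment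
    (λ { (g≈g' , b≈b') → Σ-cong g≈g' , b≈b' })
    (λ { (g , b) (g' , b') →
         A.trans (Σ-distrib (Func.to g) (λ y → Func.to g' (y B.∙ b)))
                 (A.∙-congˡ (Σ-shift (Func.to g') (Func.cong g') b))
         , B.refl })

  δ : A.Carrier → Func B.setoid A.setoid
  δ x = record
    { to   = λ y → when (y ≟ B.ε) x
    ; cong = λ {y} {y'} y≈y' → when-cong (y ≟ B.ε) (y' ≟ B.ε)
               (B.trans (B.sym y≈y')) (B.trans y≈y') (λ _ → A.refl) }

  point : Func A×B.setoid AB.setoid
  point = record
    { to   = λ (x , b) → δ x , b
    ; cong = λ (x≈x' , b≈b') → (λ y → when-congʳ (y ≟ B.ε) x≈x') , b≈b' }

  augment-point : ∀ t → augment (Func.to point t) A×B.≈ t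
  augment-point (x , b) = Σ-delta B.ε x , B.refl

  -- Maps C → B coded by tuples over the enumeration of C; `origin` is the
  -- index of the unit, so `fromTuple v` takes the value v origin at 1.
  n : ℕ
  n = EC.size

  origin : Fin n
  origin = EC.index C.ε

  fromTuple : Tuple n → Func C.setoid B.setoid
  fromTuple v = record
    { to   = v ∘ EC.index
    ; cong = λ z≈z' → B.reflexive (≡.cong v (EC.index-cong z≈z')) }

  FunBC : Set _
  FunBC = Func BC.setoid A.setoid

  fibreSum : FunBC → C.Carrier → B.Carrier → A.Carrier
  fibreSum F x y = Σⁿ n (λ v → when (v origin ≟ y) (Func.to F (fromTuple v , x)))

  fibreSum-congʸ : ∀ F x {y y'} → y B.≈ y' → fibreSum F x y A.≈ fibreSum F x y'
  fibreSum-congʸ F x y≈y' = Σⁿ-cong n (λ v → when-cong (v origin ≟ _) (v origin ≟ _)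
    (λ p → B.trans p y≈y') (λ p → B.trans p (B.sym y≈y')) (λ _ → A.refl))

  fibreSum-congˣ : ∀ F {x x'} → x C.≈ x' → ∀ y → fibreSum F x y A.≈ fibreSum F x' y
  fibreSum-congˣ F x≈x' y = Σⁿ-cong n (λ v → when-congʳ (v origin ≟ y) (Func.cong F ((λ _ → B.refl) , x≈x')))

  fibreSum-shift : ∀ F x (κ : Tuple n) y →
    Σⁿ n (λ v → when (v origin ≟ y) (Func.to F (fromTuple (λ i → v i B.∙ κ i) , x)))
      A.≈ fibreSum F x (y B.∙ κ origin)
  fibreSum-shift F x κ y = begin
    Σⁿ n (λ v → when (v origin ≟ y) (Func.to F (fromTuple (λ i → v i B.∙ κ i) , x)))
      ≈⟨ Σⁿ-cong n (λ v → when-cong (v origin ≟ y) ((v origin B.∙ κ origin) ≟ y')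
           (B.∙-congʳ) (BP.∙-cancelʳ (κ origin) _ _) (λ _ → A.refl)) ⟩
    Σⁿ n (λ v → χ (λ i → v i B.∙ κ i))
      ≈⟨ Σⁿ-shift n χ χ-cong κ ⟩
    fibreSum F x y' ∎
    where
    y' = y B.∙ κ origin
    χ : Tuple n → A.Carrier
    χ w = when (w origin ≟ y') (Func.to F (fromTuple w , x))
    χ-cong : ∀ {v w} → v ≐ w → χ v A.≈ χ w
    χ-cong v≐w = when-cong (_ ≟ y') (_ ≟ y') (B.trans (B.sym (v≐w origin))) (B.trans (v≐w origin))
      (λ _ → Func.cong F ((λ z → v≐w (EC.index z)) , C.refl))

  fibreSum-twisted : ∀ (F F' F'' : FunBC) (f : Func C.setoid B.setoid) c x y →
    (∀ h → Func.to F'' (h , x) A.≈ Func.to F (h , x) A.∙ Func.to F' ((h , x) BC.∙ (f , c))) →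
    fibreSum F'' x y A.≈ fibreSum F x y A.∙ fibreSum F' (x C.∙ c) (y B.∙ Func.to f x)
  fibreSum-twisted F F' F'' f c x y F''≈F·F' = begin
    fibreSum F'' x y
      ≈⟨ Σⁿ-cong n (λ v → A.trans (when-congʳ (v origin ≟ y) (A.trans (F''≈F·F' (fromTuple v))
                                      (A.∙-congˡ (Func.cong F' ((λ z → translate v z) , C.refl)))))
                                  (when-∙ (v origin ≟ y) _ _)) ⟩
    Σⁿ n (λ v → when (v origin ≟ y) (Func.to F (fromTuple v , x))
                A.∙ when (v origin ≟ y) (Func.to F' (fromTuple (λ i → v i B.∙ κ i) , x C.∙ c)))
      ≈⟨ Σⁿ-distrib n _ _ ⟩
    fibreSum F x y A.∙ Σⁿ n (λ v → when (v origin ≟ y) (Func.to F' (fromTuple (λ i → v i B.∙ κ i) , x C.∙ c)))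
      ≈⟨ A.∙-congˡ (fibreSum-shift F' (x C.∙ c) κ y) ⟩
    fibreSum F x y A.∙ fibreSum F' (x C.∙ c) (y B.∙ κ origin)
      ≈⟨ A.∙-congˡ (fibreSum-congʸ F' (x C.∙ c) (B.∙-congˡ κ-origin)) ⟩
    fibreSum F x y A.∙ fibreSum F' (x C.∙ c) (y B.∙ Func.to f x) ∎
    where
    κ : Tuple n
    κ i = Func.to f (EC.element i C.∙ x)
    κ-origin : κ origin B.≈ Func.to f x
    κ-origin = Func.cong f (C.trans (C.∙-congʳ (EC.element-index C.ε)) (C.identityˡ x))
    translate : ∀ v z → v (EC.index z) B.∙ Func.to f (z C.∙ x) B.≈ v (EC.index z) B.∙ κ (EC.index z)
    translate v z = B.∙-congˡ (Func.cong f (C.∙-congʳ (C.sym (EC.element-index z))))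

  pushforward : W₁.Carrier → W₂.Carrier
  pushforward (F , (f , c)) = record
    { to   = λ x → record { to = fibreSum F x ; cong = fibreSum-congʸ F x } , Func.to f x
    ; cong = λ x≈x' → fibreSum-congˣ F x≈x' , Func.cong f x≈x' }
    , c

  pushforward-homomorphism : IsGroupHomomorphism W₁.rawGroup W₂.rawGroup pushforward
  pushforward-homomorphism = multiplicative⇒homomorphism (A ≀ (B ≀ C)) ((A ≀ B) ≀ C) pushforward
    (λ { (F≈F' , (f≈f' , c≈c')) →
         (λ x → (λ y → Σⁿ-cong n (λ v → when-congʳ (v origin ≟ y) (F≈F' (fromTuple v , x)))) , f≈f' x)
         , c≈c' })
    (λ { (F , (f , c)) (F' , (f' , c')) →
         (λ x → (λ y → fibreSum-twisted F F' (proj₁ ((F , (f , c)) W₁.∙ (F' , (f' , c')))) f c x y (λ _ → A.refl)) , B.refl) , C.refl })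

  -- Surjectivity: given G : C → A ≀ B with G(x) = (g_x , β(x)), the function
  -- F(h , x) = g_x(h(1)) if h is constant and 0 otherwise has F_x = g_x.
  pushforward-surjective : ∀ t → ∃ λ u → pushforward u W₂.≈ t
  pushforward-surjective (G , c) = (F , (β , c)) , ((λ x → (λ y → fibreSum-F x y) , B.refl) , C.refl)
    where
    g : C.Carrier → Func B.setoid A.setoid
    g = proj₁ ∘ Func.to G

    β : Func C.setoid B.setoid
    β = record { to = proj₂ ∘ Func.to G ; cong = proj₂ ∘ Func.cong G }

    isConstant? : (h : Func C.setoid B.setoid) → Dec (∀ i → Func.to h (EC.element i) B.≈ Func.to h C.ε)
    isConstant? h = FinProperties.all? (λ i → Func.to h (EC.element i) ≟ Func.to h C.ε)

    F : FunBC
    F = record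
      { to   = λ (h , x) → when (isConstant? h) (Func.to (g x) (Func.to h C.ε))
      ; cong = λ { {h , x} {h' , x'} (h≈h' , x≈x') →
          when-cong (isConstant? h) (isConstant? h')
            (λ const i → B.trans (B.sym (h≈h' _)) (B.trans (const i) (h≈h' C.ε)))
            (λ const i → B.trans (h≈h' _) (B.trans (const i) (B.sym (h≈h' C.ε))))
            (λ _ → A.trans (Func.cong (g x) (h≈h' C.ε)) (proj₁ (Func.cong G x≈x') _)) } }

    -- Among tuples with v(origin) = y, only the constant tuple y is constant.
    fibreSum-F : ∀ x y → fibreSum F x y A.≈ Func.to (g x) y
    fibreSum-F x y = A.trans
      (Σⁿ-cong n (λ v → when-∧ (v origin ≟ y) (isConstant? (fromTuple v)) (v ≐? (λ _ → y))
        (λ v₀≈y const i → B.trans (B.reflexive (≡.cong v (≡.sym (EC.index-element i))))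
                                  (B.trans (const i) v₀≈y))
        (λ v≐y → v≐y origin , λ i → B.trans (v≐y _) (B.sym (v≐y origin)))
        (λ v≐y → Func.cong (g x) (v≐y origin))))
      (Σⁿ-delta n (λ _ → y) (Func.to (g x) y))

  pushforwardEpimorphism : Epimorphism (A ≀ (B ≀ C)) ((A ≀ B) ≀ C)
  pushforwardEpimorphism = record
    { ⟦_⟧ = pushforward
    ; isHomomorphism = pushforward-homomorphism
    ; surjective = pushforward-surjective }

  augmentEpimorphism : Epimorphism ((A ≀ B) ≀ C) (group A B ≀ C)
  augmentEpimorphism = splitEpimorphism≀ (A ≀ B) (group A B) C augment augment-homomorphism point augment-point

lemma2p10 : ∀ {a ℓa b ℓb c ℓc : Level}
    (A : AbelianGroup a ℓa) (B : Group b ℓb) (C : Group c ℓc) →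
    Finite (AbelianGroup.group A) → Finite B → Finite C →
    Epimorphism (AbelianGroup.group A ≀ (B ≀ C)) ((AbelianGroup.group A ≀ B) ≀ C)
    × Epimorphism ((AbelianGroup.group A ≀ B) ≀ C) (group (AbelianGroup.group A) B ≀ C)
lemma2p10 A B C _ finB finC = pushforwardEpimorphism , augmentEpimorphism
  where open WreathEpimorphisms A B C finB finC
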